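{- Let $n \ge 1$ and let $U_i, V_i$ ($i=1,2,3,4$) be matrices of order $n$ with entries in $\{0,+1,-1\}$ such that: (i) $U_iU_j^\top = U_jU_i^\top$ for all $i \ne j$; (ii) $V_iV_j^\top = V_jV_i^\top$ for all $i \ne j$; (iii) $U_i + V_i$ and $U_i - V_i$ are $(+1,-1)$ matrices for $i=1,2,3,4$; (iv) every row sum of $U_1$ equals $1$ and every row sum of $U_j$, $j=2,3,4$, equals $0$; (v) $\sum_{i=1}^4 U_iU_i^\top = (2n+1)I_n - 2J_n$ and $\sum_{i=1}^4 V_iV_i^\top = (2n+1)I_n$. Define the $(+1,-1)$ matrices of order $2n$ \[ S_j = U_j \otimes \begin{bmatrix} 1 & 1 \\ 1 & 1\end{bmatrix} + V_j \otimes \begin{bmatrix} 1 & -1 \\ -1 & 1\end{bmatrix}, \quad j=1,2,3,4, \] and suppose $S_2 = S_3$. Let $e_{2n}$ be the all-ones row vector of length $2n$ and set \[ X_1 = \begin{bmatrix} 1 & -e_{2n} \\ -e_{2n}^\top & S_1 \end{bmatrix}, \qquad X_i = \begin{bmatrix} 1 & e_{2n} \\ e_{2n}^\top & S_i \end{bmatrix}, \ i=2,3,4. \] Then $X_1, X_2, X_3, X_4$ are $\pm1$ matrices of order $2n+1$ which are pairwise amicable, satisfy $X_2 = X_3$ and $\sum_{i=1}^4 X_iX_i^\top = 4(2n+1)I_{2n+1}$ (i.e. they are propus-Williamson type matrices of order $2n+1$). If moreover all $U_i$ and $V_i$ are symmetric, then the $X_i$ are symmetric, and there is a symmetric propus-type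 Hadamard matrix of order $4(2n+1)$.
   Context: $I_m$ and $J_m$ denote the identity and all-ones matrices of order $m$; $\otimes$ is the Kronecker product. Two matrices $X,Y$ are amicable if $XY^\top = YX^\top$. A Hadamard matrix of order $m$ is an $m\times m$ $\pm1$ matrix $H$ with $HH^\top = mI_m$. A symmetric propus-type Hadamard matrix of order $4m$ is a symmetric Hadamard matrix of the form \[ \begin{bmatrix} A & B & B & D \\ B & D & -A & -B \\ B & -A & -D & B \\ D & -B & B & -A \end{bmatrix} \] where $A,B,D$ are $\pm1$ matrices of order $m$ that are pairwise amicable and satisfy $AA^\top + 2BB^\top + DD^\top = 4mI_m$. -}

module Defs where

open import Data.Nat using (ℕ; zero; suc)
import Data.Nat as ℕ
open import Data.Integer using (ℤ; +_; _+_; _-_; _*_; -_; 0ℤ; 1ℤ; -1ℤ)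
open import Data.Fin using (Fin; zero; suc; remQuot; _≟_)
open import Relation.Nullary using (yes; no)
open import Data.Product using (Σ; _×_; _,_; proj₁; proj₂)
open import Data.Sum using (_⊎_)
open import Relation.Binary.PropositionalEquality using (_≡_; _≢_)

Mat : ℕ → ℕ → Set
Mat m n = Fin m → Fin n → ℤ

∑ : ∀ {n} → (Fin n → ℤ) → ℤ
∑ {zero}  f = 0ℤ
∑ {suc n} f = f zero + ∑ (λ i → f (suc i))

_≐_ : ∀ {m n} → Mat m n → Mat m n → Set
A ≐ B = ∀ i j → A i j ≡ B i j
infix 4 _≐_

_ᵀ : ∀ {m n} → Mat m n → Mat n m
(A ᵀ) i j = A j i
infix 10 _ᵀ

_⊗ₘ_ : ∀ {m n k} → Mat m n → Mat n k → Mat m k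
(A ⊗ₘ B) i j = ∑ (λ l → A i l * B l j)

_+ₘ_ : ∀ {m n} → Mat m n → Mat m n → Mat m n
(A +ₘ B) i j = A i j + B i j

_-ₘ_ : ∀ {m n} → Mat m n → Mat m n → Mat m n
(A -ₘ B) i j = A i j - B i j

_·ₘ_ : ∀ {m n} → ℤ → Mat m n → Mat m n
(c ·ₘ A) i j = c * A i j

infixl 6 _+ₘ_ _-ₘ_
infixl 7 _⊗ₘ_ _·ₘ_

I : ∀ m → Mat m m
I m i j with i ≟ j
... | yes _ = 1ℤ
... | no  _ = 0ℤ

J : ∀ m → Mat m m
J m i j = 1ℤ

∑ₘ : ∀ {k m n} → (Fin k → Mat m n) → Mat m n
∑ₘ F i j = ∑ (λ t → F t i j)

-- Kronecker product; index (i , k) of the product is i * q + k (Data.Fin.combine)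
kron : ∀ {m n p q} → Mat m n → Mat p q → Mat (m ℕ.* p) (n ℕ.* q)
kron {m} {n} {p} {q} A B i j =
  A (proj₁ (remQuot {m} p i)) (proj₁ (remQuot {n} q j)) * B (proj₂ (remQuot {m} p i)) (proj₂ (remQuot {n} q j))

IsPM1 : ∀ {m n} → Mat m n → Set
IsPM1 A = ∀ i j → (A i j ≡ 1ℤ) ⊎ (A i j ≡ -1ℤ)

IsTernary : ∀ {m n} → Mat m n → Set
IsTernary A = ∀ i j → (A i j ≡ 0ℤ) ⊎ ((A i j ≡ 1ℤ) ⊎ (A i j ≡ -1ℤ))

Symmetric : ∀ {m} → Mat m m → Set
Symmetric A = A ≐ A ᵀ

Amicable : ∀ {m n} → Mat m n → Mat m n → Set
Amicable X Y = X ⊗ₘ Y ᵀ ≐ Y ⊗ₘ X ᵀ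

IsHadamard : ∀ m → Mat m m → Set
IsHadamard m H = IsPM1 H × (H ⊗ₘ H ᵀ ≐ (+ m) ·ₘ I m)

K₊ : Mat 2 2
K₊ i j = 1ℤ

K₋ : Mat 2 2
K₋ i j with i ≟ j
... | yes _ = 1ℤ
... | no  _ = -1ℤ

Smat : ∀ {n} → Mat n n → Mat n n → Mat (n ℕ.* 2) (n ℕ.* 2)
Smat U V = kron U K₊ +ₘ kron V K₋

border : ∀ {N} → ℤ → Mat N N → Mat (suc N) (suc N)
border s S zero    zero    = 1ℤ
border s S zero    (suc j) = s
border s S (suc i) zero    = s
border s S (suc i) (suc j) = S i j

-- X_1 (index zero) gets border -1, X_2, X_3, X_4 get border +1
Xmat : ∀ {n} → (Fin 4 → Mat n n) → (Fin 4 → Mat n n) → Fin 4 → Mat (suc (n ℕ.* 2)) (suc (n ℕ.* 2))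
Xmat U V zero    = border -1ℤ (Smat (U zero) (V zero))
Xmat U V (suc i) = border 1ℤ (Smat (U (suc i)) (V (suc i)))

-- propus block matrix [[A,B,B,D],[B,D,-A,-B],[B,-A,-D,B],[D,-B,B,-A]] of order 4m;
-- index (block r , position i) is r * m + i (Data.Fin.combine)
propusBlock : ∀ {m} → Mat m m → Mat m m → Mat m m → Fin 4 → Fin 4 → Mat m m
propusBlock A B D zero zero = A
propusBlock A B D zero (suc zero) = B
propusBlock A B D zero (suc (suc zero)) = B
propusBlock A B D zero (suc (suc (suc zero))) = D
propusBlock A B D (suc zero) zero = B
propusBlock A B D (suc zero) (suc zero) = D
propusBlock A B D (suc zero) (suc (suc zero)) = -1ℤ ·ₘ A
propusBlock A B D (suc zero) (suc (suc (suc zero))) = -1ℤ ·ₘ B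
propusBlock A B D (suc (suc zero)) zero = B
propusBlock A B D (suc (suc zero)) (suc zero) = -1ℤ ·ₘ A
propusBlock A B D (suc (suc zero)) (suc (suc zero)) = -1ℤ ·ₘ D
propusBlock A B D (suc (suc zero)) (suc (suc (suc zero))) = B
propusBlock A B D (suc (suc (suc zero))) zero = D
propusBlock A B D (suc (suc (suc zero))) (suc zero) = -1ℤ ·ₘ B
propusBlock A B D (suc (suc (suc zero))) (suc (suc zero)) = B
propusBlock A B D (suc (suc (suc zero))) (suc (suc (suc zero))) = -1ℤ ·ₘ A

propus : ∀ {m} → Mat m m → Mat m m → Mat m m → Mat (4 ℕ.* m) (4 ℕ.* m)
propus {m} A B D i j =
  propusBlock A B D (proj₁ (remQuot {4} m i)) (proj₁ (remQuot {4} m j)) (proj₂ (remQuot {4} m i)) (proj₂ (remQuot {4} m j))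

SymPropusHadamardExists : ℕ → Set
SymPropusHadamardExists m =
  Σ (Mat m m) λ A → Σ (Mat m m) λ B → Σ (Mat m m) λ D →
    IsPM1 A × IsPM1 B × IsPM1 D ×
    Amicable A B × Amicable A D × Amicable B D ×
    (A ⊗ₘ A ᵀ +ₘ (+ 2) ·ₘ (B ⊗ₘ B ᵀ) +ₘ D ⊗ₘ D ᵀ ≐ (+ (4 ℕ.* m)) ·ₘ I m) ×
    Symmetric (propus A B D) × IsHadamard (4 ℕ.* m) (propus A B D)

-- With S = U ⊗ K₊ + V ⊗ K₋ and K₊K₊ᵀ = 2K₊, K₋K₋ᵀ = 2K₋, K₊K₋ᵀ = 0, every
-- product S Sᵀ equals 2 UUᵀ ⊗ K₊ + 2 VVᵀ ⊗ K₋. Hence amicability passes from (U, V) to S and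
-- (v) gives ∑ SᵢSᵢᵀ = 4(2n+1) I − 4 J. The row sums of Sᵢ are twice those of Uᵢ, and the
-- border sign of Xᵢ is 1 − 2·(row sum of Uᵢ); this makes the bordered matrices amicable,
-- and the four border products cancel the −4 J. Finally, for symmetric, pairwise amicable
-- A, B, D with AAᵀ + 2BBᵀ + DDᵀ = 4m I the block rows of the propus array are orthogonal,
-- so A = X₁, B = X₂ = X₃, D = X₄ give a symmetric propus Hadamard matrix.

module Submission where

open import Defs
open import Data.Nat using (ℕ; suc; zero; _≤_)
import Data.Nat as ℕ
open import Data.Integer using (ℤ; +_; 1ℤ; 0ℤ; -1ℤ; _+_; _*_; _-_)
import Data.Integer.Properties as ℤ
open import Data.Integer.Tactic.RingSolver using (solve-∀)
open import Algebra.Properties.CommutativeSemigroup ℤ.*-commutativeSemigroup using (x∙yz≈y∙xz)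
open import Data.Bool using (Bool; true; false; _xor_)
import Data.Bool.Properties as Bool
open import Data.Fin using (Fin; zero; suc; combine; remQuot; _↑ˡ_; _↑ʳ_; _≟_)
import Data.Fin.Properties as Fin
open import Data.Product using (_×_; _,_; proj₁; proj₂)
open import Data.Sum using (_⊎_; inj₁; inj₂; [_,_]′)
open import Data.Empty using (⊥-elim)
open import Function using (_∘_)
open import Relation.Nullary using (yes; no; ¬_; Dec)
open import Relation.Nullary.Decidable using (toWitness)
open import Relation.Binary.PropositionalEquality
  using (_≡_; _≢_; refl; sym; trans; cong; cong₂; subst; subst₂; module ≡-Reasoning)
open ≡-Reasoning

HasRowSum : ∀ {m n} → Mat m n → ℤ → Set
HasRowSum A c = ∀ i → ∑ (A i) ≡ c

IsSign : ℤ → Set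
IsSign x = (x ≡ 1ℤ) ⊎ (x ≡ -1ℤ)

∑-cong : ∀ {n} {f g : Fin n → ℤ} → (∀ i → f i ≡ g i) → ∑ f ≡ ∑ g
∑-cong {zero}  f≗g = refl
∑-cong {suc n} f≗g = cong₂ _+_ (f≗g zero) (∑-cong (λ i → f≗g (suc i)))

∑-distrib-+ : ∀ {n} (f g : Fin n → ℤ) → ∑ (λ i → f i + g i) ≡ ∑ f + ∑ g
∑-distrib-+ {zero}  f g = refl
∑-distrib-+ {suc n} f g = begin
  f zero + g zero + ∑ (λ i → f (suc i) + g (suc i))
    ≡⟨ cong (_+_ (f zero + g zero)) (∑-distrib-+ (λ i → f (suc i)) (λ i → g (suc i))) ⟩
  f zero + g zero + (∑ (λ i → f (suc i)) + ∑ (λ i → g (suc i)))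
    ≡⟨ +-interchange (f zero) (g zero) _ _ ⟩
  f zero + ∑ (λ i → f (suc i)) + (g zero + ∑ (λ i → g (suc i))) ∎
  where
  +-interchange : ∀ a b c d → a + b + (c + d) ≡ a + c + (b + d)
  +-interchange = solve-∀

*-distribˡ-∑ : ∀ {n} (c : ℤ) (f : Fin n → ℤ) → c * ∑ f ≡ ∑ (λ i → c * f i)
*-distribˡ-∑ {zero}  c f = ℤ.*-zeroʳ c
*-distribˡ-∑ {suc n} c f =
  trans (ℤ.*-distribˡ-+ c (f zero) _) (cong (_+_ (c * f zero)) (*-distribˡ-∑ c (λ i → f (suc i))))

∑-const : ∀ n (c : ℤ) → ∑ {n} (λ _ → c) ≡ + n * c
∑-const zero    c = refl
∑-const (suc n) c = begin
  c + ∑ {n} (λ _ → c)  ≡⟨ cong (_+_ c) (∑-const n c) ⟩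
  c + + n * c          ≡⟨ cong (_+ + n * c) (ℤ.*-identityˡ c) ⟨
  1ℤ * c + + n * c     ≡⟨ ℤ.*-distribʳ-+ c 1ℤ (+ n) ⟨
  + suc n * c          ∎

∑-↑ : ∀ m {n} (f : Fin (m ℕ.+ n) → ℤ) → ∑ f ≡ ∑ (λ i → f (i ↑ˡ n)) + ∑ (λ j → f (m ↑ʳ j))
∑-↑ zero    f = sym (ℤ.+-identityˡ _)
∑-↑ (suc m) f = trans (cong (_+_ (f zero)) (∑-↑ m (λ i → f (suc i)))) (sym (ℤ.+-assoc (f zero) _ _))

∑-combine : ∀ m {n} (f : Fin (m ℕ.* n) → ℤ) → ∑ f ≡ ∑ (λ i → ∑ (λ j → f (combine {m} {n} i j)))
∑-combine zero    f = refl
∑-combine (suc m) {n} f =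
  trans (∑-↑ n f) (cong (_+_ (∑ (λ j → f (combine {suc m} zero j)))) (∑-combine m (λ k → f (n ↑ʳ k))))

combine-elim : ∀ {m n} {P : Fin (m ℕ.* n) → Set} → (∀ a b → P (combine a b)) → ∀ k → P k
combine-elim {m} {n} {P} P-combine k =
  subst P (Fin.combine-remQuot {m} n k) (P-combine (proj₁ (remQuot {m} n k)) (proj₂ (remQuot {m} n k)))

combine-elim₂ : ∀ {m n} {P : Fin (m ℕ.* n) → Fin (m ℕ.* n) → Set} →
  (∀ a b c d → P (combine a b) (combine c d)) → ∀ k l → P k l
combine-elim₂ {m} {n} {P} P-combine =
  combine-elim {m} {n} {λ k → ∀ l → P k l} (λ a b → combine-elim {m} {n} (P-combine a b))

kron-combine : ∀ {m n p q} (A : Mat m n) (B : Mat p q) a b c d →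
  kron A B (combine a b) (combine c d) ≡ A a c * B b d
kron-combine {m} {n} {p} {q} A B a b c d =
  cong₂ (λ x y → A (proj₁ x) (proj₁ y) * B (proj₂ x) (proj₂ y))
        (Fin.remQuot-combine {m} {p} a b) (Fin.remQuot-combine {n} {q} c d)

I-≡ : ∀ {m} {i j : Fin m} → i ≡ j → I m i j ≡ 1ℤ
I-≡ {i = i} {j} i≡j with i ≟ j
... | yes _   = refl
... | no  i≢j = ⊥-elim (i≢j i≡j)

I-≢ : ∀ {m} {i j : Fin m} → ¬ i ≡ j → I m i j ≡ 0ℤ
I-≢ {i = i} {j} i≢j with i ≟ j
... | yes i≡j = ⊥-elim (i≢j i≡j)
... | no  _   = refl

I-combine : ∀ {m n} (a c : Fin m) (b d : Fin n) →
  I (m ℕ.* n) (combine a b) (combine c d) ≡ I m a c * I n b d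
I-combine {m} {n} a c b d with a ≟ c | b ≟ d
... | yes refl | yes refl = I-≡ refl
... | yes refl | no b≢d = I-≢ (b≢d ∘ Fin.combine-injectiveʳ a b a d)
... | no a≢c   | _      = I-≢ (a≢c ∘ Fin.combine-injectiveˡ a b c d)

I-suc : ∀ {N} (i j : Fin N) → I (suc N) (suc i) (suc j) ≡ I N i j
I-suc {N} i j = by-cases (i ≟ j)
  where
  by-cases : Dec (i ≡ j) → I (suc N) (suc i) (suc j) ≡ I N i j
  by-cases (yes i≡j) = trans (I-≡ (cong suc i≡j)) (sym (I-≡ i≡j))
  by-cases (no  i≢j) = trans (I-≢ (i≢j ∘ Fin.suc-injective)) (sym (I-≢ i≢j))

gram-combine : ∀ {k m} {M N : Mat (k ℕ.* m) (k ℕ.* m)} (F G : Fin k → Fin k → Mat m m) →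
  (∀ r x r' y → M (combine r x) (combine r' y) ≡ F r r' x y) →
  (∀ r x r' y → N (combine r x) (combine r' y) ≡ G r r' x y) →
  ∀ r x r' y → (M ⊗ₘ N ᵀ) (combine r x) (combine r' y) ≡ ∑ (λ t → (F r t ⊗ₘ G r' t ᵀ) x y)
gram-combine {k} F G M≡F N≡G r x r' y =
  trans (∑-combine k _) (∑-cong (λ t → ∑-cong (λ z → cong₂ _*_ (M≡F r x t z) (N≡G r' y t z))))

Sblock : ℤ → ℤ → Mat 2 2
Sblock u v b d = u + v * K₋ b d

Sblock-gram : ∀ u v u' v' b b' →
  (Sblock u v ⊗ₘ Sblock u' v' ᵀ) b b' ≡ + 2 * (u * u') + + 2 * K₋ b b' * (v * v')
Sblock-gram u v u' v' b b' = expanded b b' u v u' v'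
  where
  -- The sum over Fin 2 is written out, since the ring solver does not unfold ∑.
  expanded : ∀ b b' u v u' v' →
    (u + v * K₋ b zero) * (u' + v' * K₋ b' zero)
      + ((u + v * K₋ b (suc zero)) * (u' + v' * K₋ b' (suc zero)) + 0ℤ)
    ≡ + 2 * (u * u') + + 2 * K₋ b b' * (v * v')
  expanded zero       zero       = solve-∀
  expanded zero       (suc zero) = solve-∀
  expanded (suc zero) zero       = solve-∀
  expanded (suc zero) (suc zero) = solve-∀

Smat-combine : ∀ {n} (U V : Mat n n) a b c d →
  Smat U V (combine a b) (combine c d) ≡ Sblock (U a c) (V a c) b d
Smat-combine U V a b c d =
  cong₂ _+_ (trans (kron-combine U K₊ a b c d) (ℤ.*-identityʳ (U a c))) (kron-combine V K₋ a b c d)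

Smat-gram : ∀ {n} (U₁ V₁ U₂ V₂ : Mat n n) a b a' b' →
  (Smat U₁ V₁ ⊗ₘ Smat U₂ V₂ ᵀ) (combine a b) (combine a' b')
    ≡ + 2 * (U₁ ⊗ₘ U₂ ᵀ) a a' + + 2 * K₋ b b' * (V₁ ⊗ₘ V₂ ᵀ) a a'
Smat-gram {n} U₁ V₁ U₂ V₂ a b a' b' = begin
  (Smat U₁ V₁ ⊗ₘ Smat U₂ V₂ ᵀ) (combine a b) (combine a' b')
    ≡⟨ gram-combine {n} {2} {Smat U₁ V₁} {Smat U₂ V₂}
         (λ a c → Sblock (U₁ a c) (V₁ a c)) (λ a c → Sblock (U₂ a c) (V₂ a c))
         (Smat-combine U₁ V₁) (Smat-combine U₂ V₂) a b a' b' ⟩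
  ∑ (λ c → (Sblock (U₁ a c) (V₁ a c) ⊗ₘ Sblock (U₂ a' c) (V₂ a' c) ᵀ) b b')
    ≡⟨ ∑-cong (λ c → Sblock-gram (U₁ a c) (V₁ a c) (U₂ a' c) (V₂ a' c) b b') ⟩
  ∑ (λ c → + 2 * (U₁ a c * U₂ a' c) + + 2 * K₋ b b' * (V₁ a c * V₂ a' c))
    ≡⟨ ∑-distrib-+ {n} _ _ ⟩
  ∑ (λ c → + 2 * (U₁ a c * U₂ a' c)) + ∑ (λ c → + 2 * K₋ b b' * (V₁ a c * V₂ a' c))
    ≡⟨ cong₂ _+_ (*-distribˡ-∑ {n} (+ 2) _) (*-distribˡ-∑ {n} (+ 2 * K₋ b b') _) ⟨
  + 2 * (U₁ ⊗ₘ U₂ ᵀ) a a' + + 2 * K₋ b b' * (V₁ ⊗ₘ V₂ ᵀ) a a' ∎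

Smat-amicable : ∀ {n} {U₁ V₁ U₂ V₂ : Mat n n} →
  Amicable U₁ U₂ → Amicable V₁ V₂ → Amicable (Smat U₁ V₁) (Smat U₂ V₂)
Smat-amicable {n} {U₁} {V₁} {U₂} {V₂} U-am V-am = combine-elim₂ {n} {2} λ a b a' b' →
  begin
    (Smat U₁ V₁ ⊗ₘ Smat U₂ V₂ ᵀ) (combine a b) (combine a' b')
      ≡⟨ Smat-gram U₁ V₁ U₂ V₂ a b a' b' ⟩
    + 2 * (U₁ ⊗ₘ U₂ ᵀ) a a' + + 2 * K₋ b b' * (V₁ ⊗ₘ V₂ ᵀ) a a'
      ≡⟨ cong₂ (λ x y → + 2 * x + + 2 * K₋ b b' * y) (U-am a a') (V-am a a') ⟩
    + 2 * (U₂ ⊗ₘ U₁ ᵀ) a a' + + 2 * K₋ b b' * (V₂ ⊗ₘ V₁ ᵀ) a a'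
      ≡⟨ Smat-gram U₂ V₂ U₁ V₁ a b a' b' ⟨
    (Smat U₂ V₂ ⊗ₘ Smat U₁ V₁ ᵀ) (combine a b) (combine a' b') ∎

Sblock-rowSum : ∀ u v b → ∑ (Sblock u v b) ≡ + 2 * u
Sblock-rowSum u v b = expanded b u v
  where
  expanded : ∀ b u v → u + v * K₋ b zero + (u + v * K₋ b (suc zero) + 0ℤ) ≡ + 2 * u
  expanded zero       = solve-∀
  expanded (suc zero) = solve-∀

Sblock-entry : ∀ u v b d → (Sblock u v b d ≡ u + v) ⊎ (Sblock u v b d ≡ u - v)
Sblock-entry u v zero       zero       = inj₁ (cong (_+_ u) (ℤ.*-identityʳ v))
Sblock-entry u v zero       (suc zero) = inj₂ (cong (_+_ u) (trans (ℤ.*-comm v -1ℤ) (ℤ.-1*i≡-i v)))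
Sblock-entry u v (suc zero) zero       = inj₂ (cong (_+_ u) (trans (ℤ.*-comm v -1ℤ) (ℤ.-1*i≡-i v)))
Sblock-entry u v (suc zero) (suc zero) = inj₁ (cong (_+_ u) (ℤ.*-identityʳ v))

K₋-symmetric : Symmetric K₋
K₋-symmetric zero       zero       = refl
K₋-symmetric zero       (suc zero) = refl
K₋-symmetric (suc zero) zero       = refl
K₋-symmetric (suc zero) (suc zero) = refl

K₋≡2I-1 : ∀ b b' → K₋ b b' ≡ + 2 * I 2 b b' - 1ℤ
K₋≡2I-1 zero       zero       = refl
K₋≡2I-1 zero       (suc zero) = refl
K₋≡2I-1 (suc zero) zero       = refl
K₋≡2I-1 (suc zero) (suc zero) = refl

Smat-rowSum : ∀ {n} {U : Mat n n} (V : Mat n n) {c} → HasRowSum U c → HasRowSum (Smat U V) (+ 2 * c)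
Smat-rowSum {n} {U} V {c} U-rows = combine-elim {n} {2} λ a b → begin
  ∑ (Smat U V (combine a b))
    ≡⟨ ∑-combine n {2} _ ⟩
  ∑ (λ x → ∑ (λ y → Smat U V (combine a b) (combine {n} x y)))
    ≡⟨ ∑-cong (λ x → trans (∑-cong (Smat-combine U V a b x)) (Sblock-rowSum (U a x) (V a x) b)) ⟩
  ∑ (λ x → + 2 * U a x)
    ≡⟨ *-distribˡ-∑ (+ 2) (U a) ⟨
  + 2 * ∑ (U a)
    ≡⟨ cong (_*_ (+ 2)) (U-rows a) ⟩
  + 2 * c ∎

Smat-pm1 : ∀ {n} {U V : Mat n n} → IsPM1 (U +ₘ V) → IsPM1 (U -ₘ V) → IsPM1 (Smat U V)
Smat-pm1 {n} {U} {V} U+V-pm1 U-V-pm1 = combine-elim₂ {n} {2} λ a b c d →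
  subst IsSign (sym (Smat-combine U V a b c d))
    ([ (λ e → subst IsSign (sym e) (U+V-pm1 a c)) , (λ e → subst IsSign (sym e) (U-V-pm1 a c)) ]′
       (Sblock-entry (U a c) (V a c) b d))

Smat-symmetric : ∀ {n} {U V : Mat n n} → Symmetric U → Symmetric V → Symmetric (Smat U V)
Smat-symmetric {n} {U} {V} U-sym V-sym = combine-elim₂ {n} {2} λ a b c d → begin
  Smat U V (combine a b) (combine c d)
    ≡⟨ Smat-combine U V a b c d ⟩
  U a c + V a c * K₋ b d
    ≡⟨ cong₂ _+_ (U-sym a c) (cong₂ _*_ (V-sym a c) (K₋-symmetric b d)) ⟩
  U c a + V c a * K₋ d b
    ≡⟨ Smat-combine U V c d a b ⟨
  Smat U V (combine c d) (combine a b) ∎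

∑-Smat-gram : ∀ {k n} (U V : Fin k → Mat n n) a b a' b' →
  ∑ₘ (λ i → Smat (U i) (V i) ⊗ₘ Smat (U i) (V i) ᵀ) (combine a b) (combine a' b')
    ≡ + 2 * ∑ₘ (λ i → U i ⊗ₘ U i ᵀ) a a' + + 2 * K₋ b b' * ∑ₘ (λ i → V i ⊗ₘ V i ᵀ) a a'
∑-Smat-gram {k} U V a b a' b' = begin
  ∑ (λ i → (Smat (U i) (V i) ⊗ₘ Smat (U i) (V i) ᵀ) (combine a b) (combine a' b'))
    ≡⟨ ∑-cong (λ i → Smat-gram (U i) (V i) (U i) (V i) a b a' b') ⟩
  ∑ (λ i → + 2 * (U i ⊗ₘ U i ᵀ) a a' + + 2 * K₋ b b' * (V i ⊗ₘ V i ᵀ) a a')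
    ≡⟨ ∑-distrib-+ {k} _ _ ⟩
  ∑ (λ i → + 2 * (U i ⊗ₘ U i ᵀ) a a') + ∑ (λ i → + 2 * K₋ b b' * (V i ⊗ₘ V i ᵀ) a a')
    ≡⟨ cong₂ _+_ (*-distribˡ-∑ {k} (+ 2) _) (*-distribˡ-∑ {k} (+ 2 * K₋ b b') _) ⟨
  + 2 * ∑ₘ (λ i → U i ⊗ₘ U i ᵀ) a a' + + 2 * K₋ b b' * ∑ₘ (λ i → V i ⊗ₘ V i ᵀ) a a' ∎

module _ {N} (s t : ℤ) (S T : Mat N N) where

  border-gram-corner : (border s S ⊗ₘ border t T ᵀ) zero zero ≡ 1ℤ + + N * (s * t)
  border-gram-corner = cong (_+_ 1ℤ) (∑-const N (s * t))

  border-gram-top : ∀ k → (border s S ⊗ₘ border t T ᵀ) zero (suc k) ≡ t + s * ∑ (T k)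
  border-gram-top k = cong₂ _+_ (ℤ.*-identityˡ t) (sym (*-distribˡ-∑ s (T k)))

  border-gram-left : ∀ k → (border s S ⊗ₘ border t T ᵀ) (suc k) zero ≡ s + t * ∑ (S k)
  border-gram-left k = cong₂ _+_ (ℤ.*-identityʳ s)
    (trans (∑-cong (λ l → ℤ.*-comm (S k l) t)) (sym (*-distribˡ-∑ t (S k))))

border-amicable : ∀ {N} {s t : ℤ} {S T : Mat N N} {a b : ℤ} → Amicable S T →
  HasRowSum S a → HasRowSum T b → t + s * b ≡ s + t * a → Amicable (border s S) (border t T)
border-amicable {N} {s} {t} {S} {T} {a} {b} S-T-am S-rows T-rows compatible = entry
  where
  entry : Amicable (border s S) (border t T)
  entry zero zero = begin
    (border s S ⊗ₘ border t T ᵀ) zero zero  ≡⟨ border-gram-corner s t S T ⟩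
    1ℤ + + N * (s * t)                      ≡⟨ cong (λ x → 1ℤ + + N * x) (ℤ.*-comm s t) ⟩
    1ℤ + + N * (t * s)                      ≡⟨ border-gram-corner t s T S ⟨
    (border t T ⊗ₘ border s S ᵀ) zero zero  ∎
  entry zero (suc k) = begin
    (border s S ⊗ₘ border t T ᵀ) zero (suc k)  ≡⟨ border-gram-top s t S T k ⟩
    t + s * ∑ (T k)                            ≡⟨ cong (λ x → t + s * x) (T-rows k) ⟩
    t + s * b                                  ≡⟨ compatible ⟩
    s + t * a                                  ≡⟨ cong (λ x → s + t * x) (S-rows k) ⟨
    s + t * ∑ (S k)                            ≡⟨ border-gram-top t s T S k ⟨
    (border t T ⊗ₘ border s S ᵀ) zero (suc k)  ∎
  entry (suc k) zero = begin
    (border s S ⊗ₘ border t T ᵀ) (suc k) zero  ≡⟨ border-gram-left s t S T k ⟩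
    s + t * ∑ (S k)                            ≡⟨ cong (λ x → s + t * x) (S-rows k) ⟩
    s + t * a                                  ≡⟨ compatible ⟨
    t + s * b                                  ≡⟨ cong (λ x → t + s * x) (T-rows k) ⟨
    t + s * ∑ (T k)                            ≡⟨ border-gram-left t s T S k ⟨
    (border t T ⊗ₘ border s S ᵀ) (suc k) zero  ∎
  entry (suc k) (suc k') = cong₂ _+_ (ℤ.*-comm s t) (S-T-am k k')

border-pm1 : ∀ {N} {s : ℤ} {S : Mat N N} → IsSign s → IsPM1 S → IsPM1 (border s S)
border-pm1 s-sign S-pm1 zero    zero    = inj₁ refl
border-pm1 s-sign S-pm1 zero    (suc j) = s-sign
border-pm1 s-sign S-pm1 (suc i) zero    = s-sign
border-pm1 s-sign S-pm1 (suc i) (suc j) = S-pm1 i j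

border-symmetric : ∀ {N} {s : ℤ} {S : Mat N N} → Symmetric S → Symmetric (border s S)
border-symmetric S-sym zero    zero    = refl
border-symmetric S-sym zero    (suc j) = refl
border-symmetric S-sym (suc i) zero    = refl
border-symmetric S-sym (suc i) (suc j) = S-sym i j

border-cong : ∀ {N} (s : ℤ) {S T : Mat N N} → S ≐ T → border s S ≐ border s T
border-cong s S≐T zero    zero    = refl
border-cong s S≐T zero    (suc j) = refl
border-cong s S≐T (suc i) zero    = refl
border-cong s S≐T (suc i) (suc j) = S≐T i j

module _ {k N} (s : Fin k → ℤ) (S : Fin k → Mat N N) where

  ∑-border-gram-corner : ∑ₘ (λ i → border (s i) (S i) ⊗ₘ border (s i) (S i) ᵀ) zero zero
                           ≡ ∑ (λ i → 1ℤ + + N * (s i * s i))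
  ∑-border-gram-corner = ∑-cong (λ i → border-gram-corner (s i) (s i) (S i) (S i))

  ∑-border-gram-top : ∀ p → ∑ₘ (λ i → border (s i) (S i) ⊗ₘ border (s i) (S i) ᵀ) zero (suc p)
                        ≡ ∑ (λ i → s i + s i * ∑ (S i p))
  ∑-border-gram-top p = ∑-cong (λ i → border-gram-top (s i) (s i) (S i) (S i) p)

  ∑-border-gram-left : ∀ p → ∑ₘ (λ i → border (s i) (S i) ⊗ₘ border (s i) (S i) ᵀ) (suc p) zero
                         ≡ ∑ (λ i → s i + s i * ∑ (S i p))
  ∑-border-gram-left p = ∑-cong (λ i → border-gram-left (s i) (s i) (S i) (S i) p)

  ∑-border-gram-inner : ∀ p q → ∑ₘ (λ i → border (s i) (S i) ⊗ₘ border (s i) (S i) ᵀ) (suc p) (suc q)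
                          ≡ ∑ (λ i → s i * s i) + ∑ₘ (λ i → S i ⊗ₘ S i ᵀ) p q
  ∑-border-gram-inner p q = ∑-distrib-+ {k} _ _

signed : Bool → ℤ → ℤ
signed false x = x
signed true  x = -1ℤ * x

signedₘ : ∀ {m} → Bool → Mat m m → Mat m m
signedₘ false M = M
signedₘ true  M = -1ℤ ·ₘ M

propusNegated : Fin 4 → Fin 4 → Bool
propusNegated (suc zero)             (suc (suc zero))       = true
propusNegated (suc zero)             (suc (suc (suc zero))) = true
propusNegated (suc (suc zero))       (suc zero)             = true
propusNegated (suc (suc zero))       (suc (suc zero))       = true
propusNegated (suc (suc (suc zero))) (suc zero)             = true
propusNegated (suc (suc (suc zero))) (suc (suc (suc zero))) = true
propusNegated _                      _                      = false

pick : ∀ {m} → Mat m m → Mat m m → Mat m m → Fin 3 → Mat m m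
pick A B D zero             = A
pick A B D (suc zero)       = B
pick A B D (suc (suc zero)) = D

propusPart : Fin 4 → Fin 4 → Fin 3
propusPart zero                   zero                   = zero
propusPart zero                   (suc (suc (suc zero))) = suc (suc zero)
propusPart (suc zero)             (suc zero)             = suc (suc zero)
propusPart (suc zero)             (suc (suc zero))       = zero
propusPart (suc (suc zero))       (suc zero)             = zero
propusPart (suc (suc zero))       (suc (suc zero))       = suc (suc zero)
propusPart (suc (suc (suc zero))) zero                   = suc (suc zero)
propusPart (suc (suc (suc zero))) (suc (suc (suc zero))) = zero
propusPart _                      _                      = suc zero

module _ {m} (A B D : Mat m m) where

  propusBlock-signed : ∀ r r' →
    propusBlock A B D r r' ≡ signedₘ (propusNegated r r') (pick A B D (propusPart r r'))
  propusBlock-signed zero                   zero                   = refl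
  propusBlock-signed zero                   (suc zero)             = refl
  propusBlock-signed zero                   (suc (suc zero))       = refl
  propusBlock-signed zero                   (suc (suc (suc zero))) = refl
  propusBlock-signed (suc zero)             zero                   = refl
  propusBlock-signed (suc zero)             (suc zero)             = refl
  propusBlock-signed (suc zero)             (suc (suc zero))       = refl
  propusBlock-signed (suc zero)             (suc (suc (suc zero))) = refl
  propusBlock-signed (suc (suc zero))       zero                   = refl
  propusBlock-signed (suc (suc zero))       (suc zero)             = refl
  propusBlock-signed (suc (suc zero))       (suc (suc zero))       = refl
  propusBlock-signed (suc (suc zero))       (suc (suc (suc zero))) = refl
  propusBlock-signed (suc (suc (suc zero))) zero                   = refl
  propusBlock-signed (suc (suc (suc zero))) (suc zero)             = refl
  propusBlock-signed (suc (suc (suc zero))) (suc (suc zero))       = refl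
  propusBlock-signed (suc (suc (suc zero))) (suc (suc (suc zero))) = refl

propusNegated-comm : ∀ r r' → propusNegated r r' ≡ propusNegated r' r
propusNegated-comm =
  toWitness {a? = Fin.all? λ r → Fin.all? λ r' → propusNegated r r' Bool.≟ propusNegated r' r} _

propusPart-comm : ∀ r r' → propusPart r r' ≡ propusPart r' r
propusPart-comm =
  toWitness {a? = Fin.all? λ r → Fin.all? λ r' → propusPart r r' Fin.≟ propusPart r' r} _

signedₘ-entry : ∀ {m} σ (M : Mat m m) i j → signedₘ σ M i j ≡ signed σ (M i j)
signedₘ-entry false M i j = refl
signedₘ-entry true  M i j = refl

signed-sign : ∀ σ {x} → IsSign x → IsSign (signed σ x)
signed-sign false x-sign       = x-sign
signed-sign true  (inj₁ refl) = inj₂ refl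
signed-sign true  (inj₂ refl) = inj₁ refl

signed-* : ∀ σ σ' x y → signed σ x * signed σ' y ≡ signed (σ xor σ') (x * y)
signed-* false false x y = refl
signed-* false true  x y = sign-outwards x y
  where
  sign-outwards : ∀ x y → x * (-1ℤ * y) ≡ -1ℤ * (x * y)
  sign-outwards = solve-∀
signed-* true  false x y = ℤ.*-assoc -1ℤ x y
signed-* true  true  x y = negated-twice x y
  where
  negated-twice : ∀ x y → -1ℤ * x * (-1ℤ * y) ≡ x * y
  negated-twice = solve-∀

∑-signed : ∀ {n} σ (f : Fin n → ℤ) → ∑ (λ i → signed σ (f i)) ≡ signed σ (∑ f)
∑-signed false f = refl
∑-signed true  f = sym (*-distribˡ-∑ -1ℤ f)

signedₘ-gram : ∀ {m} σ σ' (P Q : Mat m m) x y →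
  (signedₘ σ P ⊗ₘ signedₘ σ' Q ᵀ) x y ≡ signed (σ xor σ') ((P ⊗ₘ Q ᵀ) x y)
signedₘ-gram {m} σ σ' P Q x y = begin
  ∑ (λ z → signedₘ σ P x z * signedₘ σ' Q y z)
    ≡⟨ ∑-cong (λ z → trans (cong₂ _*_ (signedₘ-entry σ P x z) (signedₘ-entry σ' Q y z))
                          (signed-* σ σ' (P x z) (Q y z))) ⟩
  ∑ (λ z → signed (σ xor σ') (P x z * Q y z))
    ≡⟨ ∑-signed {m} (σ xor σ') _ ⟩
  signed (σ xor σ') ((P ⊗ₘ Q ᵀ) x y) ∎

gram₃ : (aa ab ad bb bd dd : ℤ) → Fin 3 → Fin 3 → ℤ
gram₃ aa ab ad bb bd dd zero             zero             = aa
gram₃ aa ab ad bb bd dd zero             (suc zero)       = ab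
gram₃ aa ab ad bb bd dd zero             (suc (suc zero)) = ad
gram₃ aa ab ad bb bd dd (suc zero)       zero             = ab
gram₃ aa ab ad bb bd dd (suc zero)       (suc zero)       = bb
gram₃ aa ab ad bb bd dd (suc zero)       (suc (suc zero)) = bd
gram₃ aa ab ad bb bd dd (suc (suc zero)) zero             = ad
gram₃ aa ab ad bb bd dd (suc (suc zero)) (suc zero)       = bd
gram₃ aa ab ad bb bd dd (suc (suc zero)) (suc (suc zero)) = dd

-- After case analysis on the two block rows, each sum in propus-rows-orthogonal is one of
-- the following (terms in the order t = 0, 1, 2, 3; -1ℤ * x comes from a negated block).
private
  abbd : ∀ a b d → a + (b + (b + (d + 0ℤ))) ≡ 1ℤ * (a + + 2 * b + d)
  abbd = solve-∀
  bdab : ∀ a b d → b + (d + (a + (b + 0ℤ))) ≡ 1ℤ * (a + + 2 * b + d)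
  bdab = solve-∀
  badb : ∀ a b d → b + (a + (d + (b + 0ℤ))) ≡ 1ℤ * (a + + 2 * b + d)
  badb = solve-∀
  dbba : ∀ a b d → d + (b + (b + (a + 0ℤ))) ≡ 1ℤ * (a + + 2 * b + d)
  dbba = solve-∀
  xyx̄ȳ : ∀ x y → x + (y + (-1ℤ * x + (-1ℤ * y + 0ℤ))) ≡ 0ℤ
  xyx̄ȳ = solve-∀
  xx̄ȳy : ∀ x y → x + (-1ℤ * x + (-1ℤ * y + (y + 0ℤ))) ≡ 0ℤ
  xx̄ȳy = solve-∀
  xȳyx̄ : ∀ x y → x + (-1ℤ * y + (y + (-1ℤ * x + 0ℤ))) ≡ 0ℤ
  xȳyx̄ = solve-∀

propus-rows-orthogonal : ∀ r r' (aa ab ad bb bd dd : ℤ) →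
  ∑ (λ t → signed (propusNegated r t xor propusNegated r' t)
                  (gram₃ aa ab ad bb bd dd (propusPart r t) (propusPart r' t)))
    ≡ I 4 r r' * (aa + + 2 * bb + dd)
propus-rows-orthogonal zero                   zero                   aa ab ad bb bd dd = abbd aa bb dd
propus-rows-orthogonal zero                   (suc zero)             aa ab ad bb bd dd = xyx̄ȳ ab bd
propus-rows-orthogonal zero                   (suc (suc zero))       aa ab ad bb bd dd = xx̄ȳy ab bd
propus-rows-orthogonal zero                   (suc (suc (suc zero))) aa ab ad bb bd dd = xȳyx̄ ad bb
propus-rows-orthogonal (suc zero)             zero                   aa ab ad bb bd dd = xyx̄ȳ ab bd
propus-rows-orthogonal (suc zero)             (suc zero)             aa ab ad bb bd dd = bdab aa bb dd
propus-rows-orthogonal (suc zero)             (suc (suc zero))       aa ab ad bb bd dd = xȳyx̄ bb ad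
propus-rows-orthogonal (suc zero)             (suc (suc (suc zero))) aa ab ad bb bd dd = xx̄ȳy bd ab
propus-rows-orthogonal (suc (suc zero))       zero                   aa ab ad bb bd dd = xx̄ȳy ab bd
propus-rows-orthogonal (suc (suc zero))       (suc zero)             aa ab ad bb bd dd = xȳyx̄ bb ad
propus-rows-orthogonal (suc (suc zero))       (suc (suc zero))       aa ab ad bb bd dd = badb aa bb dd
propus-rows-orthogonal (suc (suc zero))       (suc (suc (suc zero))) aa ab ad bb bd dd = xyx̄ȳ bd ab
propus-rows-orthogonal (suc (suc (suc zero))) zero                   aa ab ad bb bd dd = xȳyx̄ ad bb
propus-rows-orthogonal (suc (suc (suc zero))) (suc zero)             aa ab ad bb bd dd = xx̄ȳy bd ab
propus-rows-orthogonal (suc (suc (suc zero))) (suc (suc zero))       aa ab ad bb bd dd = xyx̄ȳ bd ab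
propus-rows-orthogonal (suc (suc (suc zero))) (suc (suc (suc zero))) aa ab ad bb bd dd = dbba aa bb dd

module _ {m} {A B D : Mat m m} where

  propus-entry : ∀ r x r' y →
    propus A B D (combine r x) (combine r' y)
      ≡ signedₘ (propusNegated r r') (pick A B D (propusPart r r')) x y
  propus-entry r x r' y = begin
    propus A B D (combine r x) (combine r' y)
      ≡⟨ cong₂ (λ u v → propusBlock A B D (proj₁ u) (proj₁ v) (proj₂ u) (proj₂ v))
               (Fin.remQuot-combine {4} {m} r x) (Fin.remQuot-combine {4} {m} r' y) ⟩
    propusBlock A B D r r' x y
      ≡⟨ cong (λ M → M x y) (propusBlock-signed A B D r r') ⟩
    signedₘ (propusNegated r r') (pick A B D (propusPart r r')) x y ∎

  pick-pm1 : IsPM1 A → IsPM1 B → IsPM1 D → ∀ i → IsPM1 (pick A B D i)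
  pick-pm1 A-pm1 B-pm1 D-pm1 zero             = A-pm1
  pick-pm1 A-pm1 B-pm1 D-pm1 (suc zero)       = B-pm1
  pick-pm1 A-pm1 B-pm1 D-pm1 (suc (suc zero)) = D-pm1

  propus-pm1 : IsPM1 A → IsPM1 B → IsPM1 D → IsPM1 (propus A B D)
  propus-pm1 A-pm1 B-pm1 D-pm1 = combine-elim₂ {4} {m} λ r x r' y →
    subst IsSign (sym (trans (propus-entry r x r' y) (signedₘ-entry (propusNegated r r') _ x y)))
      (signed-sign (propusNegated r r') (pick-pm1 A-pm1 B-pm1 D-pm1 (propusPart r r') x y))

  pick-symmetric : Symmetric A → Symmetric B → Symmetric D → ∀ i → Symmetric (pick A B D i)
  pick-symmetric A-sym B-sym D-sym zero             = A-sym
  pick-symmetric A-sym B-sym D-sym (suc zero)       = B-sym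
  pick-symmetric A-sym B-sym D-sym (suc (suc zero)) = D-sym

  propus-symmetric : Symmetric A → Symmetric B → Symmetric D → Symmetric (propus A B D)
  propus-symmetric A-sym B-sym D-sym = combine-elim₂ {4} {m} λ r x r' y → begin
    propus A B D (combine r x) (combine r' y)
      ≡⟨ trans (propus-entry r x r' y) (signedₘ-entry (propusNegated r r') _ x y) ⟩
    signed (propusNegated r r') (pick A B D (propusPart r r') x y)
      ≡⟨ cong₂ signed (propusNegated-comm r r')
               (trans (pick-symmetric A-sym B-sym D-sym (propusPart r r') x y)
                      (cong (λ i → pick A B D i y x) (propusPart-comm r r'))) ⟩
    signed (propusNegated r' r) (pick A B D (propusPart r' r) y x)
      ≡⟨ trans (propus-entry r' y r x) (signedₘ-entry (propusNegated r' r) _ y x) ⟨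
    propus A B D (combine r' y) (combine r x) ∎

  pick-gram : Amicable A B → Amicable A D → Amicable B D → ∀ x y i j →
    (pick A B D i ⊗ₘ pick A B D j ᵀ) x y
      ≡ gram₃ ((A ⊗ₘ A ᵀ) x y) ((A ⊗ₘ B ᵀ) x y) ((A ⊗ₘ D ᵀ) x y)
              ((B ⊗ₘ B ᵀ) x y) ((B ⊗ₘ D ᵀ) x y) ((D ⊗ₘ D ᵀ) x y) i j
  pick-gram AB-am AD-am BD-am x y zero             zero             = refl
  pick-gram AB-am AD-am BD-am x y zero             (suc zero)       = refl
  pick-gram AB-am AD-am BD-am x y zero             (suc (suc zero)) = refl
  pick-gram AB-am AD-am BD-am x y (suc zero)       zero             = sym (AB-am x y)
  pick-gram AB-am AD-am BD-am x y (suc zero)       (suc zero)       = refl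
  pick-gram AB-am AD-am BD-am x y (suc zero)       (suc (suc zero)) = refl
  pick-gram AB-am AD-am BD-am x y (suc (suc zero)) zero             = sym (AD-am x y)
  pick-gram AB-am AD-am BD-am x y (suc (suc zero)) (suc zero)       = sym (BD-am x y)
  pick-gram AB-am AD-am BD-am x y (suc (suc zero)) (suc (suc zero)) = refl

  propus-gram : ∀ {c} → Amicable A B → Amicable A D → Amicable B D →
    A ⊗ₘ A ᵀ +ₘ (+ 2) ·ₘ (B ⊗ₘ B ᵀ) +ₘ D ⊗ₘ D ᵀ ≐ c ·ₘ I m →
    propus A B D ⊗ₘ propus A B D ᵀ ≐ c ·ₘ I (4 ℕ.* m)
  propus-gram {c} AB-am AD-am BD-am weighted-sum = combine-elim₂ {4} {m} λ r x r' y → begin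
    (propus A B D ⊗ₘ propus A B D ᵀ) (combine r x) (combine r' y)
      ≡⟨ gram-combine {4} {m} {propus A B D} {propus A B D} block block
                      propus-entry propus-entry r x r' y ⟩
    ∑ (λ t → (block r t ⊗ₘ block r' t ᵀ) x y)
      ≡⟨ ∑-cong (block-gram r r' x y) ⟩
    ∑ (λ t → signed (propusNegated r t xor propusNegated r' t)
                    (table x y (propusPart r t) (propusPart r' t)))
      ≡⟨ propus-rows-orthogonal r r' _ _ _ _ _ _ ⟩
    I 4 r r' * ((A ⊗ₘ A ᵀ) x y + + 2 * (B ⊗ₘ B ᵀ) x y + (D ⊗ₘ D ᵀ) x y)
      ≡⟨ cong (_*_ (I 4 r r')) (weighted-sum x y) ⟩
    I 4 r r' * (c * I m x y)
      ≡⟨ x∙yz≈y∙xz (I 4 r r') c (I m x y) ⟩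
    c * (I 4 r r' * I m x y)
      ≡⟨ cong (_*_ c) (I-combine r r' x y) ⟨
    c * I (4 ℕ.* m) (combine r x) (combine r' y) ∎
    where
    block : Fin 4 → Fin 4 → Mat m m
    block r r' = signedₘ (propusNegated r r') (pick A B D (propusPart r r'))

    table : Fin m → Fin m → Fin 3 → Fin 3 → ℤ
    table x y = gram₃ ((A ⊗ₘ A ᵀ) x y) ((A ⊗ₘ B ᵀ) x y) ((A ⊗ₘ D ᵀ) x y)
                      ((B ⊗ₘ B ᵀ) x y) ((B ⊗ₘ D ᵀ) x y) ((D ⊗ₘ D ᵀ) x y)

    block-gram : ∀ r r' x y t →
      (block r t ⊗ₘ block r' t ᵀ) x y
        ≡ signed (propusNegated r t xor propusNegated r' t)
                 (table x y (propusPart r t) (propusPart r' t))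
    block-gram r r' x y t = begin
      (block r t ⊗ₘ block r' t ᵀ) x y
        ≡⟨ signedₘ-gram (propusNegated r t) (propusNegated r' t)
                        (pick A B D (propusPart r t)) (pick A B D (propusPart r' t)) x y ⟩
      signed σ ((pick A B D (propusPart r t) ⊗ₘ pick A B D (propusPart r' t) ᵀ) x y)
        ≡⟨ cong (signed σ) (pick-gram AB-am AD-am BD-am x y (propusPart r t) (propusPart r' t)) ⟩
      signed σ (table x y (propusPart r t) (propusPart r' t)) ∎
      where
      σ = propusNegated r t xor propusNegated r' t

weighted-gram-sum : ∀ {m} (X : Fin 4 → Mat m m) → X (suc zero) ≐ X (suc (suc zero)) →
  X zero ⊗ₘ X zero ᵀ +ₘ (+ 2) ·ₘ (X (suc zero) ⊗ₘ X (suc zero) ᵀ)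
    +ₘ X (suc (suc (suc zero))) ⊗ₘ X (suc (suc (suc zero))) ᵀ
    ≐ ∑ₘ (λ i → X i ⊗ₘ X i ᵀ)
weighted-gram-sum X X₂≐X₃ p q = begin
  a + + 2 * b + d          ≡⟨ regroup a b d ⟩
  a + (b + (b + (d + 0ℤ))) ≡⟨ cong (λ b' → a + (b + (b' + (d + 0ℤ))))
                                   (∑-cong (λ l → cong₂ _*_ (X₂≐X₃ p l) (X₂≐X₃ q l))) ⟩
  ∑ₘ (λ i → X i ⊗ₘ X i ᵀ) p q ∎
  where
  a = (X zero ⊗ₘ X zero ᵀ) p q
  b = (X (suc zero) ⊗ₘ X (suc zero) ᵀ) p q
  d = (X (suc (suc (suc zero))) ⊗ₘ X (suc (suc (suc zero))) ᵀ) p q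
  regroup : ∀ a b d → a + + 2 * b + d ≡ a + (b + (b + (d + 0ℤ)))
  regroup = solve-∀

symmetric-propus-Hadamard : ∀ {m} (X : Fin 4 → Mat m m) →
  (∀ i → IsPM1 (X i)) → (∀ i → Symmetric (X i)) → (∀ i j → i ≢ j → Amicable (X i) (X j)) →
  X (suc zero) ≐ X (suc (suc zero)) → ∑ₘ (λ i → X i ⊗ₘ X i ᵀ) ≐ (+ (4 ℕ.* m)) ·ₘ I m →
  SymPropusHadamardExists m
symmetric-propus-Hadamard {m} X X-pm1 X-sym X-am X₂≐X₃ X-gram =
  X ₁ , X ₂ , X ₄ , X-pm1 ₁ , X-pm1 ₂ , X-pm1 ₄ , AB-am , AD-am , BD-am , weighted ,
  propus-symmetric (X-sym ₁) (X-sym ₂) (X-sym ₄) ,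
  propus-pm1 (X-pm1 ₁) (X-pm1 ₂) (X-pm1 ₄) ,
  propus-gram {c = + (4 ℕ.* m)} AB-am AD-am BD-am weighted
  where
  ₁ ₂ ₄ : Fin 4
  ₁ = zero
  ₂ = suc zero
  ₄ = suc (suc (suc zero))
  AB-am = X-am ₁ ₂ (λ ())
  AD-am = X-am ₁ ₄ (λ ())
  BD-am = X-am ₂ ₄ (λ ())
  weighted : X ₁ ⊗ₘ X ₁ ᵀ +ₘ (+ 2) ·ₘ (X ₂ ⊗ₘ X ₂ ᵀ) +ₘ X ₄ ⊗ₘ X ₄ ᵀ ≐ (+ (4 ℕ.* m)) ·ₘ I m
  weighted p q = trans (weighted-gram-sum X X₂≐X₃ p q) (X-gram p q)

borderSign : Fin 4 → ℤ
borderSign zero    = -1ℤ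
borderSign (suc _) = 1ℤ

rowSumU : Fin 4 → ℤ
rowSumU zero    = 1ℤ
rowSumU (suc _) = 0ℤ

borderSign-sign : ∀ i → IsSign (borderSign i)
borderSign-sign zero    = inj₂ refl
borderSign-sign (suc _) = inj₁ refl

-- borderSign i = 1 - 2 rowSumU i, so both sides equal 1 - 4 rowSumU i rowSumU j.
border-compatible : ∀ i j →
  borderSign j + borderSign i * (+ 2 * rowSumU j) ≡ borderSign i + borderSign j * (+ 2 * rowSumU i)
border-compatible zero    zero    = refl
border-compatible zero    (suc _) = refl
border-compatible (suc _) zero    = refl
border-compatible (suc _) (suc _) = refl

Xmat≡border : ∀ {n} (U V : Fin 4 → Mat n n) i → Xmat U V i ≡ border (borderSign i) (Smat (U i) (V i))
Xmat≡border U V zero    = refl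
Xmat≡border U V (suc _) = refl

corner-arith : ∀ N → let e = 1ℤ + + N * 1ℤ in e + (e + (e + (e + 0ℤ))) ≡ + (4 ℕ.* suc N) * 1ℤ
corner-arith N = trans (four-copies (+ N)) (cong (_* 1ℤ) (sym (ℤ.pos-* 4 (suc N))))
  where
  four-copies : ∀ x → let e = 1ℤ + x * 1ℤ in e + (e + (e + (e + 0ℤ))) ≡ + 4 * (1ℤ + x) * 1ℤ
  four-copies = solve-∀

inner-arith : ∀ n (δ : ℤ) b b' →
  + 4 + (+ 2 * (+ (2 ℕ.* n ℕ.+ 1) * δ - + 2 * 1ℤ) + + 2 * K₋ b b' * (+ (2 ℕ.* n ℕ.+ 1) * δ))
    ≡ + (4 ℕ.* suc (n ℕ.* 2)) * (δ * I 2 b b')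
inner-arith n δ b b' = begin
  + 4 + (+ 2 * (c * δ - + 2 * 1ℤ) + + 2 * K₋ b b' * (c * δ))
    ≡⟨ cong (λ κ → + 4 + (+ 2 * (c * δ - + 2 * 1ℤ) + + 2 * κ * (c * δ))) (K₋≡2I-1 b b') ⟩
  + 4 + (+ 2 * (c * δ - + 2 * 1ℤ) + + 2 * (+ 2 * I 2 b b' - 1ℤ) * (c * δ))
    ≡⟨ cong (λ c → + 4 + (+ 2 * (c * δ - + 2 * 1ℤ) + + 2 * (+ 2 * I 2 b b' - 1ℤ) * (c * δ))) c≡2n+1 ⟩
  + 4 + (+ 2 * ((+ 2 * + n + 1ℤ) * δ - + 2 * 1ℤ) + + 2 * (+ 2 * I 2 b b' - 1ℤ) * ((+ 2 * + n + 1ℤ) * δ))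
    ≡⟨ polynomial (+ n) δ (I 2 b b') ⟩
  + 4 * (1ℤ + + n * + 2) * (δ * I 2 b b')
    ≡⟨ cong (λ c → c * (δ * I 2 b b')) 4[2n+1]≡ ⟨
  + (4 ℕ.* suc (n ℕ.* 2)) * (δ * I 2 b b') ∎
  where
  c = + (2 ℕ.* n ℕ.+ 1)
  c≡2n+1 : c ≡ + 2 * + n + 1ℤ
  c≡2n+1 = trans (ℤ.pos-+ (2 ℕ.* n) 1) (cong (_+ 1ℤ) (ℤ.pos-* 2 n))
  4[2n+1]≡ : + (4 ℕ.* suc (n ℕ.* 2)) ≡ + 4 * (1ℤ + + n * + 2)
  4[2n+1]≡ = trans (ℤ.pos-* 4 (suc (n ℕ.* 2))) (cong (λ x → + 4 * (1ℤ + x)) (ℤ.pos-* n 2))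
  polynomial : ∀ x δ ι →
    + 4 + (+ 2 * ((+ 2 * x + 1ℤ) * δ - + 2 * 1ℤ) + + 2 * (+ 2 * ι - 1ℤ) * ((+ 2 * x + 1ℤ) * δ))
      ≡ + 4 * (1ℤ + x * + 2) * (δ * ι)
  polynomial = solve-∀

module _ {n} (U V : Fin 4 → Mat n n) where

  private
    S : Fin 4 → Mat (n ℕ.* 2) (n ℕ.* 2)
    S i = Smat (U i) (V i)

  Xmat-pm1 : (∀ i → IsPM1 (U i +ₘ V i)) → (∀ i → IsPM1 (U i -ₘ V i)) → ∀ i → IsPM1 (Xmat U V i)
  Xmat-pm1 U+V-pm1 U-V-pm1 i = subst IsPM1 (sym (Xmat≡border U V i))
    (border-pm1 (borderSign-sign i) (Smat-pm1 {U = U i} {V i} (U+V-pm1 i) (U-V-pm1 i)))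

  Xmat-symmetric : (∀ i → Symmetric (U i)) → (∀ i → Symmetric (V i)) → ∀ i → Symmetric (Xmat U V i)
  Xmat-symmetric U-sym V-sym i = subst Symmetric (sym (Xmat≡border U V i))
    (border-symmetric (Smat-symmetric {U = U i} {V i} (U-sym i) (V-sym i)))

  module _ (U-rows : ∀ i → HasRowSum (U i) (rowSumU i)) where

    private
      S-rows : ∀ i → HasRowSum (S i) (+ 2 * rowSumU i)
      S-rows i = Smat-rowSum (V i) (U-rows i)

    Xmat-amicable : (∀ i j → i ≢ j → Amicable (U i) (U j)) → (∀ i j → i ≢ j → Amicable (V i) (V j)) →
      ∀ i j → i ≢ j → Amicable (Xmat U V i) (Xmat U V j)
    Xmat-amicable U-am V-am i j i≢j = subst₂ Amicable (sym (Xmat≡border U V i)) (sym (Xmat≡border U V j))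
      (border-amicable (Smat-amicable {U₁ = U i} {V i} {U j} {V j} (U-am i j i≢j) (V-am i j i≢j))
                       (S-rows i) (S-rows j) (border-compatible i j))

    Xmat-gram-top : ∀ p → ∑ₘ (λ i → Xmat U V i ⊗ₘ Xmat U V i ᵀ) zero (suc p) ≡ 0ℤ
    Xmat-gram-top p = trans (∑-border-gram-top borderSign S p)
      (∑-cong (λ i → cong (λ r → borderSign i + borderSign i * r) (S-rows i p)))

    Xmat-gram-left : ∀ p → ∑ₘ (λ i → Xmat U V i ⊗ₘ Xmat U V i ᵀ) (suc p) zero ≡ 0ℤ
    Xmat-gram-left p = trans (∑-border-gram-left borderSign S p)
      (∑-cong (λ i → cong (λ r → borderSign i + borderSign i * r) (S-rows i p)))

  module _ (UU-sum : ∑ₘ (λ i → U i ⊗ₘ U i ᵀ) ≐ (+ (2 ℕ.* n ℕ.+ 1)) ·ₘ I n -ₘ (+ 2) ·ₘ J n)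
           (VV-sum : ∑ₘ (λ i → V i ⊗ₘ V i ᵀ) ≐ (+ (2 ℕ.* n ℕ.+ 1)) ·ₘ I n) where

    Xmat-gram-inner : ∀ a b a' b' →
      ∑ₘ (λ i → Xmat U V i ⊗ₘ Xmat U V i ᵀ) (suc (combine a b)) (suc (combine a' b'))
        ≡ + (4 ℕ.* suc (n ℕ.* 2)) * I (suc (n ℕ.* 2)) (suc (combine a b)) (suc (combine a' b'))
    Xmat-gram-inner a b a' b' = begin
      ∑ₘ (λ i → Xmat U V i ⊗ₘ Xmat U V i ᵀ) (suc (combine a b)) (suc (combine a' b'))
        ≡⟨ ∑-border-gram-inner borderSign S (combine a b) (combine a' b') ⟩
      + 4 + ∑ₘ (λ i → S i ⊗ₘ S i ᵀ) (combine a b) (combine a' b')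
        ≡⟨ cong (_+_ (+ 4)) (∑-Smat-gram U V a b a' b') ⟩
      + 4 + (+ 2 * ∑ₘ (λ i → U i ⊗ₘ U i ᵀ) a a' + + 2 * K₋ b b' * ∑ₘ (λ i → V i ⊗ₘ V i ᵀ) a a')
        ≡⟨ cong₂ (λ u v → + 4 + (+ 2 * u + + 2 * K₋ b b' * v)) (UU-sum a a') (VV-sum a a') ⟩
      + 4 + (+ 2 * (c * I n a a' - + 2 * 1ℤ) + + 2 * K₋ b b' * (c * I n a a'))
        ≡⟨ inner-arith n (I n a a') b b' ⟩
      + (4 ℕ.* suc (n ℕ.* 2)) * (I n a a' * I 2 b b')
        ≡⟨ cong (_*_ (+ (4 ℕ.* suc (n ℕ.* 2)))) (trans (I-suc _ _) (I-combine a a' b b')) ⟨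
      + (4 ℕ.* suc (n ℕ.* 2)) * I (suc (n ℕ.* 2)) (suc (combine a b)) (suc (combine a' b')) ∎
      where
      c = + (2 ℕ.* n ℕ.+ 1)

    Xmat-gram-sum : (∀ i → HasRowSum (U i) (rowSumU i)) →
      ∑ₘ (λ i → Xmat U V i ⊗ₘ Xmat U V i ᵀ) ≐ (+ (4 ℕ.* suc (n ℕ.* 2))) ·ₘ I (suc (n ℕ.* 2))
    Xmat-gram-sum U-rows zero    zero    =
      trans (∑-border-gram-corner borderSign S) (corner-arith (n ℕ.* 2))
    Xmat-gram-sum U-rows zero    (suc p) =
      trans (Xmat-gram-top U-rows p) (sym (ℤ.*-zeroʳ (+ (4 ℕ.* suc (n ℕ.* 2)))))
    Xmat-gram-sum U-rows (suc p) zero    =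
      trans (Xmat-gram-left U-rows p) (sym (ℤ.*-zeroʳ (+ (4 ℕ.* suc (n ℕ.* 2)))))
    Xmat-gram-sum U-rows (suc p) (suc q) = combine-elim₂ {n} {2} Xmat-gram-inner p q

-- Neither n ≥ 1 nor the ternary entries of U and V are needed: condition (iii) alone fixes
-- every entry of the Sᵢ.
mainTheorem3 : (n : ℕ) → 1 ≤ n → (U V : Fin 4 → Mat n n) →
    (∀ i → IsTernary (U i)) → (∀ i → IsTernary (V i)) →
    (∀ i j → i ≢ j → Amicable (U i) (U j)) →
    (∀ i j → i ≢ j → Amicable (V i) (V j)) →
    (∀ i → IsPM1 (U i +ₘ V i)) → (∀ i → IsPM1 (U i -ₘ V i)) →
    (∀ r → ∑ (U zero r) ≡ 1ℤ) → (∀ j → j ≢ zero → ∀ r → ∑ (U j r) ≡ 0ℤ) →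
    (∑ₘ (λ i → U i ⊗ₘ U i ᵀ) ≐ (+ (2 ℕ.* n ℕ.+ 1)) ·ₘ I n -ₘ (+ 2) ·ₘ J n) →
    (∑ₘ (λ i → V i ⊗ₘ V i ᵀ) ≐ (+ (2 ℕ.* n ℕ.+ 1)) ·ₘ I n) →
    (Smat (U (suc zero)) (V (suc zero)) ≐ Smat (U (suc (suc zero))) (V (suc (suc zero)))) →
    (∀ i → IsPM1 (Xmat U V i)) ×
    (∀ i j → i ≢ j → Amicable (Xmat U V i) (Xmat U V j)) ×
    (Xmat U V (suc zero) ≐ Xmat U V (suc (suc zero))) ×
    (∑ₘ (λ i → Xmat U V i ⊗ₘ Xmat U V i ᵀ) ≐ (+ (4 ℕ.* suc (n ℕ.* 2))) ·ₘ I (suc (n ℕ.* 2))) ×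
    ((∀ i → Symmetric (U i)) → (∀ i → Symmetric (V i)) →
      (∀ i → Symmetric (Xmat U V i)) × SymPropusHadamardExists (suc (n ℕ.* 2)))
mainTheorem3 n _ U V _ _ U-am V-am U+V-pm1 U-V-pm1 U₀-rows Uⱼ-rows UU-sum VV-sum S₂≐S₃ =
  X-pm1 , X-am , X₂≐X₃ , X-gram ,
  λ U-sym V-sym → let X-sym = Xmat-symmetric U V U-sym V-sym in
    X-sym , symmetric-propus-Hadamard (Xmat U V) X-pm1 X-sym X-am X₂≐X₃ X-gram
  where
  U-rows : ∀ i → HasRowSum (U i) (rowSumU i)
  U-rows zero    = U₀-rows
  U-rows (suc j) = Uⱼ-rows (suc j) λ ()

  X-pm1 = Xmat-pm1 U V U+V-pm1 U-V-pm1
  X-am = Xmat-amicable U V U-rows U-am V-am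
  X₂≐X₃ = border-cong 1ℤ S₂≐S₃
  X-gram = Xmat-gram-sum U V UU-sum VV-sum U-rows
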